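{- Let $m\geq 2$ and $d\equiv 1\pmod 6$, and let $f=2^m-1$. There exists a $(\mathbb Z_2^m\times\mathbb Z_d,\{2^f\},3,1)$-difference family.
   Context: Let $(G,+)$ be a finite abelian group. A partial spread of $G$ is a family $\Sigma$ of subgroups of $G$ whose members pairwise intersect trivially; it has type $\{n_1^{f_1},\dots,n_t^{f_t}\}$ if it consists of exactly $f_i$ subgroups of order $n_i$ for each $i$ (and no others). For a triple $T=\{a,b,c\}$ of three distinct elements of $G$, $\Delta T$ is the multiset $\{\pm(a-b),\pm(a-c),\pm(b-c)\}$, and for a set $\mathcal T$ of triples, $\Delta\mathcal T$ is the multiset union of the $\Delta T$. For a partial spread $\Sigma$, a $(G,\Sigma,3,1)$-difference family is a set $\mathcal T$ of triples of $G$ with $\Delta\mathcal T=G\setminus\bigcup_{S\in\Sigma}S$ as multisets (each element outside the union occurs exactly once, elements of the union do not occur). A $(G,\tau,3,1)$-difference family is a $(G,\Sigma,3,1)$-difference family for some partial spread $\Sigma$ of $G$ of type $\tau$. -}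

module Defs where

open import Data.Nat using (ℕ; suc; _+_; _∸_; NonZero)
open import Data.Nat.DivMod using (_mod_)
open import Data.Bool using (Bool; false; _xor_)
import Data.Bool.Properties as BoolP
open import Data.Fin using (Fin; toℕ)
import Data.Fin.Properties as FinP
open import Data.Vec using (Vec; zipWith; replicate)
import Data.Vec.Properties as VecP
open import Data.Product using (_×_; _,_; Σ; ∃)
import Data.Product.Properties as ProdP
open import Data.List using (List; []; _∷_; _++_; length; filter; concatMap)
open import Data.List.Membership.Propositional using (_∈_)
open import Data.List.Relation.Unary.Unique.Propositional using (Unique)
open import Data.List.Relation.Unary.All using (All)
open import Data.List.Relation.Unary.AllPairs using (AllPairs)
open import Relation.Binary.PropositionalEquality using (_≡_; _≢_)
open import Relation.Binary.Definitions using (DecidableEquality)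
open import Relation.Nullary using (¬_)

module Group (m d : ℕ) .{{_ : NonZero d}} where

  G : Set
  G = Vec Bool m × Fin d

  _+G_ : G → G → G
  (u , a) +G (v , b) = zipWith _xor_ u v , ((toℕ a + toℕ b) mod d)

  -G_ : G → G
  -G (u , a) = u , ((d ∸ toℕ a) mod d)

  0G : G
  0G = replicate m false , (0 mod d)

  _-G_ : G → G → G
  x -G y = x +G (-G y)

  _≟G_ : DecidableEquality G
  _≟G_ = ProdP.≡-dec (VecP.≡-dec BoolP._≟_) FinP._≟_

  count : G → List G → ℕ
  count x xs = length (filter (x ≟G_) xs)

  record Subgroup : Set where
    field
      elems   : List G
      unique  : Unique elems
      has-0   : 0G ∈ elems
      closed+ : ∀ {x y} → x ∈ elems → y ∈ elems → (x +G y) ∈ elems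
      closed- : ∀ {x} → x ∈ elems → (-G x) ∈ elems
  open Subgroup public

  order : Subgroup → ℕ
  order S = length (elems S)

  TrivInter : Subgroup → Subgroup → Set
  TrivInter S T = ∀ {x} → x ∈ elems S → x ∈ elems T → x ≡ 0G

  PartialSpread : List Subgroup → Set
  PartialSpread Σs = AllPairs TrivInter Σs

  -- partial spread of type {n^k}: exactly k members, all of order n
  HasType : ℕ → ℕ → List Subgroup → Set
  HasType n k Σs = (length Σs ≡ k) × All (λ S → order S ≡ n) Σs

  InUnion : G → List Subgroup → Set
  InUnion x Σs = ∃ λ S → S ∈ Σs × x ∈ elems S

  Triple : Set
  Triple = G × G × G

  Distinct : Triple → Set
  Distinct (a , b , c) = (a ≢ b) × (a ≢ c) × (b ≢ c)

  ΔT : Triple → List G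
  ΔT (a , b , c) = (a -G b) ∷ (b -G a) ∷ (a -G c) ∷ (c -G a) ∷ (b -G c) ∷ (c -G b) ∷ []

  Δ : List Triple → List G
  Δ = concatMap ΔT

  -- (G,Σ,3,1)-difference family: ΔT = G \ ⋃Σ as multisets
  IsDiffFamily : List Subgroup → List Triple → Set
  IsDiffFamily Σs Ts =
    All Distinct Ts ×
    (∀ x → (InUnion x Σs → count x (Δ Ts) ≡ 0) × (¬ InUnion x Σs → count x (Δ Ts) ≡ 1))

  ExistsDiffFamilyOfType : ℕ → ℕ → Set
  ExistsDiffFamilyOfType n k =
    Σ (List Subgroup) λ Σs → PartialSpread Σs × HasType n k Σs ×
      Σ (List Triple) λ Ts → IsDiffFamily Σs Ts

module Submission where

-- Write d = 6n + 1.  Heffter's first difference problem has a solution: there are n triples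
-- {i, p, i + p} partitioning {1, …, 3n} (when n ≡ 0, 1 mod 4, the Skolem case) or
-- {1, …, 3n − 1} ∪ {3n + 1} (when n ≡ 2, 3 mod 4, the hooked Skolem case).  Together with
-- their negatives modulo d these numbers are every nonzero residue exactly once, so the base
-- blocks {0, i, i + p} form a cyclic (d, 3, 1) difference family of ℤ_d.
-- Let σ be an orthomorphism of ℤ₂^m, i.e. both σ and v ↦ v + σ v are permutations; for m ≥ 2
-- take multiplication by a primitive element on a decomposition of ℤ₂^m into copies of 𝔽₄ and
-- at most one 𝔽₈.  Lift every base block to the 2^m triples {(0, 0), (v, i), (σ v, i + p)}.
-- The ℤ₂^m-parts of their differences run through v, σ v and v + σ v, so every element with
-- nonzero ℤ_d-part is a difference exactly once, while ℤ₂^m × {0} is the union of the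
-- 2^m − 1 subgroups {0, (u, 0)} of order 2.

open import Defs
open import Data.Nat using (ℕ; zero; suc; _+_; _*_; _∸_; _^_; _%_; _/_; _≤_; _<_; s≤s; z≤n; NonZero)
open import Data.Nat.Properties
  using ( +-suc; +-identityʳ; +-comm; *-comm; <-irrefl; ≤∧≢⇒<; <⇒≢; <⇒≤; ≤-refl; ≤-trans; <-trans; ≤-<-trans
        ; n≤1+n; m≤m+n; m<m+n; m+n∸n≡m; m+n∸m≡n; m∸n≤m; +-∸-assoc; +-∸-comm; m+[n∸m]≡n
        ; [m+n]∸[m+o]≡n∸o; ∸-monoʳ-<; m<n⇒0<n∸m; n≢0⇒n>0 )
import Data.Nat.Properties as ℕ
open import Data.Nat.DivMod
  using (_mod_; m≡m%n+[m/n]*n; %-distribˡ-+; m%n%n≡m%n; [m+n]%n≡m%n; m<n⇒m%n≡m; n%n≡0)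
open import Data.Nat.Tactic.RingSolver using (solve-∀)
open import Data.Bool using (Bool; true; false; _xor_; T)
import Data.Bool.Properties as Bool
open import Data.Fin using (Fin; zero; toℕ)
open import Data.Fin.Properties using (toℕ-fromℕ<; toℕ-injective; toℕ<n) renaming (_≟_ to _≟F_)
open import Data.Vec using (Vec; []; _∷_; zipWith; replicate; take; drop) renaming (_++_ to _++ᵥ_)
import Data.Vec.Properties as Vec
open import Data.List using (List; []; _∷_; _++_; [_]; map; concatMap; filter; length; foldr)
open import Data.List.Properties
  using ( filter-++; length-++; length-map; filter-none; map-++; map-∘; map-cong; ++-assoc; ++-identityʳ
        ; concatMap-++; concatMap-map; concatMap-cong; map-concatMap )
open import Data.List.Membership.Propositional using (_∈_)
open import Data.List.Membership.Propositional.Properties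
  using (∈-map⁺; ∈-map⁻; ∈-++⁺ˡ; ∈-++⁺ʳ; ∈-filter⁺)
open import Data.List.Relation.Unary.Any using (here; there)
open import Data.List.Relation.Unary.All as All using (All; []; _∷_)
import Data.List.Relation.Unary.All.Properties as All
open import Data.List.Relation.Unary.AllPairs as AllPairs using ([]; _∷_)
import Data.List.Relation.Unary.AllPairs.Properties as AllPairs
open import Data.List.Relation.Unary.Unique.Propositional using (Unique)
import Data.List.Relation.Unary.Unique.Propositional.Properties as Unique
open import Data.List.Relation.Binary.Disjoint.Propositional using (Disjoint)
open import Data.List.Relation.Binary.Permutation.Propositional
  using (_↭_; prep; swap; ↭-refl; ↭-sym; ↭-trans; ↭-reflexive; module PermutationReasoning)
open import Data.List.Relation.Binary.Permutation.Propositional.Properties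
  using (filter-↭; ↭-length; ++⁺ˡ; ++⁺ʳ; ++⁺; ++-comm; shift; shifts; ∷↭∷ʳ; map⁺; ∈-resp-↭)
open import Data.Maybe as Maybe using (Maybe; just; nothing)
open import Data.Product using (∃; _×_; _,_; proj₁; proj₂)
import Data.Product.Properties as Product
open import Data.Sum as Sum using (_⊎_; inj₁; inj₂)
open import Data.Empty using (⊥-elim)
open import Data.Unit using (tt)
open import Function using (_∘_)
open import Function.Definitions using (Injective; StrictlyInverseˡ; StrictlyInverseʳ)
open import Relation.Binary.Definitions using (DecidableEquality)
open import Relation.Binary.PropositionalEquality
  using (_≡_; _≢_; refl; sym; trans; cong; cong₂; subst; module ≡-Reasoning)
open import Relation.Nullary using (¬_; yes; no)
open import Relation.Unary using (Decidable)
open import Relation.Unary.Properties using (∁?)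

module Multiplicity {A : Set} (_≟_ : DecidableEquality A) where

  count : A → List A → ℕ
  count x xs = length (filter (x ≟_) xs)

  count-++ : ∀ x xs ys → count x (xs ++ ys) ≡ count x xs + count x ys
  count-++ x xs ys = trans (cong length (filter-++ (x ≟_) xs ys)) (length-++ (filter (x ≟_) xs))

  count-↭ : ∀ x {xs ys} → xs ↭ ys → count x xs ≡ count x ys
  count-↭ x xs↭ys = ↭-length (filter-↭ (x ≟_) xs↭ys)

  count-absent : ∀ {x xs} → All (x ≢_) xs → count x xs ≡ 0
  count-absent {x} x∉xs = cong length (filter-none (x ≟_) x∉xs)

  count-unique : ∀ {x xs} → Unique xs → x ∈ xs → count x xs ≡ 1
  count-unique {x} (x∉xs ∷ _) (here refl) with x ≟ x
  ... | yes _   = cong suc (count-absent x∉xs)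
  ... | no x≢x = ⊥-elim (x≢x refl)
  count-unique {x} {y ∷ _} (y∉ys ∷ ys-unique) (there x∈ys) with x ≟ y
  ... | yes refl = ⊥-elim (All.lookup y∉ys x∈ys refl)
  ... | no _     = count-unique ys-unique x∈ys

module _ {A B : Set} (_≟A_ : DecidableEquality A) (_≟B_ : DecidableEquality B) where

  private
    module #A = Multiplicity _≟A_
    module #B = Multiplicity _≟B_

  count-map-injective : ∀ {f : A → B} → Injective _≡_ _≡_ f →
                        ∀ a xs → #B.count (f a) (map f xs) ≡ #A.count a xs
  count-map-injective f-injective a [] = refl
  count-map-injective {f} f-injective a (x ∷ xs) with f a ≟B f x | a ≟A x
  ... | yes _     | yes _    = cong suc (count-map-injective f-injective a xs)
  ... | no _      | no _     = count-map-injective f-injective a xs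
  ... | yes fa≡fx | no a≢x   = ⊥-elim (a≢x (f-injective fa≡fx))
  ... | no fa≢fx  | yes refl = ⊥-elim (fa≢fx refl)

  count-concatMap : ∀ {C : Set} {x y} (f : C → List A) (g : C → List B) {cs} →
                    All (λ c → #A.count x (f c) ≡ #B.count y (g c)) cs →
                    #A.count x (concatMap f cs) ≡ #B.count y (concatMap g cs)
  count-concatMap f g [] = refl
  count-concatMap {x = x} {y} f g {c ∷ cs} (eq ∷ eqs) = begin
    #A.count x (f c ++ concatMap f cs)             ≡⟨ #A.count-++ x (f c) _ ⟩
    #A.count x (f c) + #A.count x (concatMap f cs) ≡⟨ cong₂ _+_ eq (count-concatMap f g eqs) ⟩
    #B.count y (g c) + #B.count y (concatMap g cs) ≡⟨ #B.count-++ y (g c) _ ⟨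
    #B.count y (g c ++ concatMap g cs)             ∎
    where open ≡-Reasoning

length-filter+length-filter-∁ : ∀ {A : Set} {P : A → Set} (P? : Decidable P) xs →
  length (filter P? xs) + length (filter (∁? P?) xs) ≡ length xs
length-filter+length-filter-∁ P? [] = refl
length-filter+length-filter-∁ P? (x ∷ xs) with P? x
... | yes _ = cong suc (length-filter+length-filter-∁ P? xs)
... | no _  = trans (+-suc _ _) (cong suc (length-filter+length-filter-∁ P? xs))

toList-proj₁ : ∀ {A : Set} {P : A → Set} {xs} (pxs : All P xs) → map proj₁ (All.toList pxs) ≡ xs
toList-proj₁ [] = refl
toList-proj₁ (_ ∷ pxs) = cong (_ ∷_) (toList-proj₁ pxs)

concatMap-concatMap : ∀ {A B C : Set} (f : B → List C) (g : A → List B) xs →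
                      concatMap f (concatMap g xs) ≡ concatMap (concatMap f ∘ g) xs
concatMap-concatMap f g [] = refl
concatMap-concatMap f g (x ∷ xs) =
  trans (concatMap-++ f (g x) (concatMap g xs)) (cong (concatMap f (g x) ++_) (concatMap-concatMap f g xs))

module _ {A B : Set} where

  concatMap⁺ : ∀ (f : A → List B) {xs ys} → xs ↭ ys → concatMap f xs ↭ concatMap f ys
  concatMap⁺ f _↭_.refl        = ↭-refl
  concatMap⁺ f (prep x p)      = ++⁺ˡ (f x) (concatMap⁺ f p)
  concatMap⁺ f (swap x y p)    = ↭-trans (shifts (f x) (f y)) (++⁺ˡ (f y) (++⁺ˡ (f x) (concatMap⁺ f p)))
  concatMap⁺ f (_↭_.trans p q) = ↭-trans (concatMap⁺ f p) (concatMap⁺ f q)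

  concatMap-cong-↭ : ∀ {f g : A → List B} → (∀ x → f x ↭ g x) → ∀ xs → concatMap f xs ↭ concatMap g xs
  concatMap-cong-↭ f↭g [] = ↭-refl
  concatMap-cong-↭ f↭g (x ∷ xs) = ++⁺ (f↭g x) (concatMap-cong-↭ f↭g xs)

  concatMap-++-↭ : ∀ (f g : A → List B) xs →
                   concatMap (λ x → f x ++ g x) xs ↭ concatMap f xs ++ concatMap g xs
  concatMap-++-↭ f g [] = ↭-refl
  concatMap-++-↭ f g (x ∷ xs) = begin
    (f x ++ g x) ++ concatMap (λ x → f x ++ g x) xs  ≡⟨ ++-assoc (f x) (g x) _ ⟩
    f x ++ g x ++ concatMap (λ x → f x ++ g x) xs    ↭⟨ ++⁺ˡ (f x) (++⁺ˡ (g x) (concatMap-++-↭ f g xs)) ⟩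
    f x ++ g x ++ concatMap f xs ++ concatMap g xs   ↭⟨ ++⁺ˡ (f x) (shifts (g x) (concatMap f xs)) ⟩
    f x ++ concatMap f xs ++ g x ++ concatMap g xs   ≡⟨ ++-assoc (f x) (concatMap f xs) _ ⟨
    (f x ++ concatMap f xs) ++ g x ++ concatMap g xs ∎
    where open PermutationReasoning

concatMap-transpose : ∀ {S V B : Set} (h : S → V → B) ss vs →
  concatMap (λ v → map (λ s → h s v) ss) vs ↭ concatMap (λ s → map (h s) vs) ss
concatMap-transpose {V = V} {B} h [] vs = ↭-reflexive (nil vs)
  where
  nil : ∀ vs → concatMap {A = V} {B = B} (λ _ → []) vs ≡ []
  nil [] = refl
  nil (_ ∷ vs) = nil vs
concatMap-transpose h (s ∷ ss) vs = begin
  concatMap (λ v → (h s v ∷ []) ++ map (λ s → h s v) ss) vs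
    ↭⟨ concatMap-++-↭ (λ v → h s v ∷ []) (λ v → map (λ s → h s v) ss) vs ⟩
  concatMap (λ v → h s v ∷ []) vs ++ concatMap (λ v → map (λ s → h s v) ss) vs
    ≡⟨ cong (_++ _) (singletons vs) ⟩
  map (h s) vs ++ concatMap (λ v → map (λ s → h s v) ss) vs
    ↭⟨ ++⁺ˡ (map (h s) vs) (concatMap-transpose h ss vs) ⟩
  map (h s) vs ++ concatMap (λ s → map (h s) vs) ss ∎
  where
  open PermutationReasoning
  singletons : ∀ vs → concatMap (λ v → h s v ∷ []) vs ≡ map (h s) vs
  singletons [] = refl
  singletons (v ∷ vs) = cong (h s v ∷_) (singletons vs)

module PermutationCheck {A : Set} (_≟_ : DecidableEquality A) where

  remove : A → List A → Maybe (List A)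
  remove x [] = nothing
  remove x (y ∷ ys) with x ≟ y
  ... | yes _ = just ys
  ... | no _  = Maybe.map (y ∷_) (remove x ys)

  remove-↭ : ∀ x ys {zs} → remove x ys ≡ just zs → ys ↭ x ∷ zs
  remove-↭ x (y ∷ ys) eq with x ≟ y
  remove-↭ x (y ∷ ys) refl | yes refl = ↭-refl
  ... | no _ with remove x ys in removed
  remove-↭ x (y ∷ ys) refl | no _ | just zs = ↭-trans (prep y (remove-↭ x ys removed)) (swap y x ↭-refl)

  isPermutation : List A → List A → Bool
  isPermutation [] [] = true
  isPermutation [] (_ ∷ _) = false
  isPermutation (x ∷ xs) ys with remove x ys
  ... | just zs = isPermutation xs zs
  ... | nothing = false

  isPermutation-sound : ∀ xs ys → T (isPermutation xs ys) → xs ↭ ys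
  isPermutation-sound [] [] _ = ↭-refl
  isPermutation-sound (x ∷ xs) ys ok with remove x ys in removed
  ... | just zs = ↭-trans (prep x (isPermutation-sound xs zs ok)) (↭-sym (remove-↭ x ys removed))

-- Arithmetic progressions and cyclic difference families of ℤ_d

progression : ℕ → ℕ → ℕ → List ℕ
progression s a zero = []
progression s a (suc k) = a ∷ progression s (s + a) k

progression-++ : ∀ s a k l → progression s a (k + l) ≡ progression s a k ++ progression s (k * s + a) l
progression-++ s a zero l = refl
progression-++ s a (suc k) l = cong (a ∷_) (begin
  progression s (s + a) (k + l)
    ≡⟨ progression-++ s (s + a) k l ⟩
  progression s (s + a) k ++ progression s (k * s + (s + a)) l
    ≡⟨ cong (λ b → progression s (s + a) k ++ progression s b l) (next-start s a k) ⟩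
  progression s (s + a) k ++ progression s (suc k * s + a) l ∎)
  where
  open ≡-Reasoning
  next-start : ∀ s a k → k * s + (s + a) ≡ suc k * s + a
  next-start = solve-∀

interval-++ : ∀ a k l → progression 1 a (k + l) ≡ progression 1 a k ++ progression 1 (a + k) l
interval-++ a k l = trans (progression-++ 1 a k l) (cong (λ b → progression 1 a k ++ progression 1 b l) (start a k))
  where
  start : ∀ a k → k * 1 + a ≡ a + k
  start = solve-∀

∈-interval⁻ : ∀ {x a k} → x ∈ progression 1 a k → a ≤ x × x < a + k
∈-interval⁻ {a = a} {suc k} (here refl) = ≤-refl , subst (a <_) (sym (+-suc a k)) (s≤s (m≤m+n a k))
∈-interval⁻ {x} {a} {suc k} (there x∈) with ∈-interval⁻ x∈
... | a<x , x<a+k = ≤-trans (n≤1+n a) a<x , subst (x <_) (sym (+-suc a k)) x<a+k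

∈-interval⁺ : ∀ {x a k} → a ≤ x → x < a + k → x ∈ progression 1 a k
∈-interval⁺ {x} {a} {zero} a≤x x<a+0 =
  ⊥-elim (<-irrefl refl (≤-trans x<a+0 (subst (_≤ x) (sym (+-identityʳ a)) a≤x)))
∈-interval⁺ {x} {a} {suc k} a≤x x<a+1+k with a ℕ.≟ x
... | yes refl = here refl
... | no a≢x   = there (∈-interval⁺ (≤∧≢⇒< a≤x a≢x) (subst (x <_) (+-suc a k) x<a+1+k))

interval-unique : ∀ a k → Unique (progression 1 a k)
interval-unique a zero = []
interval-unique a (suc k) =
  All.tabulate (λ x∈ a≡x → <-irrefl a≡x (proj₁ (∈-interval⁻ x∈))) ∷ interval-unique (suc a) k

module _ where
  open Multiplicity ℕ._≟_

  count-interval-∈ : ∀ {x a k} → a ≤ x → x < a + k → count x (progression 1 a k) ≡ 1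
  count-interval-∈ a≤x x<a+k = count-unique (interval-unique _ _) (∈-interval⁺ a≤x x<a+k)

  count-interval-< : ∀ {x a k} → x < a → count x (progression 1 a k) ≡ 0
  count-interval-< {x} {a} {k} x<a =
    count-absent (All.tabulate (λ {y} y∈ x≡y → <-irrefl x≡y (≤-trans x<a (proj₁ (∈-interval⁻ {y} {a} {k} y∈)))))

last∷interval : ∀ c k → c + k ∷ progression 1 c k ↭ progression 1 c (suc k)
last∷interval c k = begin
  c + k ∷ progression 1 c k                      ↭⟨ ∷↭∷ʳ (c + k) (progression 1 c k) ⟩
  progression 1 c k ++ progression 1 (c + k) 1   ≡⟨ interval-++ c k 1 ⟨
  progression 1 c (k + 1)                        ≡⟨ cong (progression 1 c) (+-comm k 1) ⟩
  progression 1 c (suc k)                        ∎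
  where open PermutationReasoning

interleave : ∀ a k → progression 1 a (k + k) ↭ progression 2 a k ++ progression 2 (suc a) k
interleave a zero = ↭-refl
interleave a (suc k) = begin
  a ∷ progression 1 (suc a) (k + suc k)
    ≡⟨ cong (λ l → a ∷ progression 1 (suc a) l) (+-suc k k) ⟩
  a ∷ suc a ∷ progression 1 (2 + a) (k + k)
    ↭⟨ prep a (prep (suc a) (interleave (2 + a) k)) ⟩
  a ∷ suc a ∷ progression 2 (2 + a) k ++ progression 2 (3 + a) k
    ↭⟨ prep a (shift (suc a) (progression 2 (2 + a) k) _) ⟨
  a ∷ progression 2 (2 + a) k ++ suc a ∷ progression 2 (3 + a) k ∎
  where open PermutationReasoning

interleave-balanced : ∀ a {k l} → k ≡ l ⊎ k ≡ suc l →
                      progression 1 a (k + l) ↭ progression 2 a k ++ progression 2 (suc a) l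
interleave-balanced a {l = l} (inj₁ refl) = interleave a l
interleave-balanced a {l = l} (inj₂ refl) =
  prep a (↭-trans (interleave (suc a) l) (++-comm (progression 2 (suc a) l) _))

reflect-interval : ∀ c k b → map ((b + (c + k)) ∸_) (progression 1 (suc b) k) ↭ progression 1 c k
reflect-interval c zero b = ↭-refl
reflect-interval c (suc k) b = begin
  (b + (c + suc k) ∸ suc b) ∷ map ((b + (c + suc k)) ∸_) (progression 1 (2 + b) k)
    ≡⟨ cong₂ (λ x e → x ∷ map (e ∸_) (progression 1 (2 + b) k)) largest shifted ⟩
  c + k ∷ map ((suc b + (c + k)) ∸_) (progression 1 (2 + b) k)
    ↭⟨ prep (c + k) (reflect-interval c k (suc b)) ⟩
  c + k ∷ progression 1 c k
    ↭⟨ last∷interval c k ⟩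
  progression 1 c (suc k) ∎
  where
  open PermutationReasoning
  shifted : b + (c + suc k) ≡ suc b + (c + k)
  shifted = trans (cong (b +_) (+-suc c k)) (+-suc b (c + k))
  largest : b + (c + suc k) ∸ suc b ≡ c + k
  largest = trans (cong (_∸ suc b) shifted) (m+n∸m≡n b (c + k))

triple : ℕ × ℕ → List ℕ
triple (i , p) = i ∷ p ∷ i + p ∷ []

triples : List (ℕ × ℕ) → List ℕ
triples = concatMap triple

-- The differences of the block {0, i, i + p} of ℤ_d, in the order in which ΔT lists them.
differences : ℕ → ℕ × ℕ → List ℕ
differences d (i , p) = d ∸ i ∷ i ∷ d ∸ (i + p) ∷ i + p ∷ d ∸ p ∷ p ∷ []

IsBaseBlock : ℕ → ℕ × ℕ → Set
IsBaseBlock d (i , p) = 1 ≤ i × 1 ≤ p × i + p < d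

IsCyclicDifferenceFamily : ℕ → List (ℕ × ℕ) → Set
IsCyclicDifferenceFamily d B =
  All (IsBaseBlock d) B × concatMap (differences d) B ↭ progression 1 1 (d ∸ 1)

CyclicDifferenceFamily : ℕ → Set
CyclicDifferenceFamily d = ∃ (IsCyclicDifferenceFamily d)

differences-↭ : ∀ d b → differences d b ↭ triple b ++ map (d ∸_) (triple b)
differences-↭ d (i , p) = begin
  d ∸ i ∷ i ∷ d ∸ (i + p) ∷ i + p ∷ d ∸ p ∷ p ∷ []
    ↭⟨ swap (d ∸ i) i ↭-refl ⟩
  i ∷ d ∸ i ∷ d ∸ (i + p) ∷ i + p ∷ d ∸ p ∷ p ∷ []
    ↭⟨ prep i (shift p (d ∸ i ∷ d ∸ (i + p) ∷ i + p ∷ d ∸ p ∷ []) []) ⟩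
  i ∷ p ∷ d ∸ i ∷ d ∸ (i + p) ∷ i + p ∷ d ∸ p ∷ []
    ↭⟨ prep i (prep p (shift (i + p) (d ∸ i ∷ d ∸ (i + p) ∷ []) (d ∸ p ∷ []))) ⟩
  i ∷ p ∷ i + p ∷ d ∸ i ∷ d ∸ (i + p) ∷ d ∸ p ∷ []
    ↭⟨ prep i (prep p (prep (i + p) (prep (d ∸ i) (swap (d ∸ (i + p)) (d ∸ p) ↭-refl)))) ⟩
  i ∷ p ∷ i + p ∷ d ∸ i ∷ d ∸ p ∷ d ∸ (i + p) ∷ [] ∎
  where open PermutationReasoning

tiling⇒cyclicDifferenceFamily : ∀ {d B T} → triples B ↭ T →
  T ++ map (suc d ∸_) T ↭ progression 1 1 d → IsCyclicDifferenceFamily (suc d) B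
tiling⇒cyclicDifferenceFamily {d} {B} {T} B↭T tiling = blocks , (begin
  concatMap (differences (suc d)) B
    ↭⟨ concatMap-cong-↭ (differences-↭ (suc d)) B ⟩
  concatMap (λ b → triple b ++ map (suc d ∸_) (triple b)) B
    ↭⟨ concatMap-++-↭ triple (map (suc d ∸_) ∘ triple) B ⟩
  triples B ++ concatMap (map (suc d ∸_) ∘ triple) B
    ≡⟨ cong (triples B ++_) (map-concatMap (suc d ∸_) triple B) ⟨
  triples B ++ map (suc d ∸_) (triples B)
    ↭⟨ ++⁺ B↭T (map⁺ (suc d ∸_) B↭T) ⟩
  T ++ map (suc d ∸_) T
    ↭⟨ tiling ⟩
  progression 1 1 d ∎)
  where
  open PermutationReasoning
  bounded : All (λ x → 1 ≤ x × x < suc d) (triples B)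
  bounded = All.tabulate (λ x∈ → ∈-interval⁻ (∈-resp-↭ tiling (∈-++⁺ˡ (∈-resp-↭ B↭T x∈))))
  blocks : All (IsBaseBlock (suc d)) B
  blocks = All.map (λ { (i-ok ∷ p-ok ∷ sum-ok ∷ []) → proj₁ i-ok , proj₁ p-ok , proj₂ sum-ok })
                   (All.map⁻ (All.concat⁻ bounded))

skolemTarget : ℕ → List ℕ
skolemTarget n = progression 1 1 (3 * n)

-- Indexed by n for the order n + 1.
hookedTarget : ℕ → List ℕ
hookedTarget n = progression 1 1 (2 + 3 * n) ++ [ 4 + 3 * n ]

skolem-tiling : ∀ L → progression 1 1 L ++ map (suc (L + L) ∸_) (progression 1 1 L) ↭ progression 1 1 (L + L)
skolem-tiling L = begin
  progression 1 1 L ++ map (suc (L + L) ∸_) (progression 1 1 L)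
    ↭⟨ ++⁺ˡ (progression 1 1 L) (reflect-interval (suc L) L 0) ⟩
  progression 1 1 L ++ progression 1 (suc L) L
    ≡⟨ interval-++ 1 L L ⟨
  progression 1 1 (L + L) ∎
  where open PermutationReasoning

hooked-tiling : ∀ L → let T = progression 1 1 L ++ [ 2 + L ] in
  T ++ map (3 + (L + L) ∸_) T ↭ progression 1 1 (2 + (L + L))
hooked-tiling L = begin
  (I ++ [ 2 + L ]) ++ map (d ∸_) (I ++ [ 2 + L ])
    ≡⟨ ++-assoc I [ 2 + L ] _ ⟩
  I ++ 2 + L ∷ map (d ∸_) (I ++ [ 2 + L ])
    ≡⟨ cong (λ xs → I ++ 2 + L ∷ xs) (map-++ (d ∸_) I [ 2 + L ]) ⟩
  I ++ 2 + L ∷ map (d ∸_) I ++ [ d ∸ (2 + L) ]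
    ≡⟨ cong (λ x → I ++ 2 + L ∷ map (d ∸_) I ++ [ x ]) (m+n∸n≡m (suc L) L) ⟩
  I ++ 2 + L ∷ map (d ∸_) I ++ [ 1 + L ]
    ↭⟨ ++⁺ˡ I (prep (2 + L) (++⁺ʳ [ 1 + L ] (reflect-interval (3 + L) L 0))) ⟩
  I ++ 2 + L ∷ progression 1 (3 + L) L ++ [ 1 + L ]
    ↭⟨ ++⁺ˡ I (prep (2 + L) (++-comm (progression 1 (3 + L) L) [ 1 + L ])) ⟩
  I ++ 2 + L ∷ 1 + L ∷ progression 1 (3 + L) L
    ↭⟨ ++⁺ˡ I (swap (2 + L) (1 + L) ↭-refl) ⟩
  I ++ progression 1 (1 + L) (2 + L)
    ≡⟨ interval-++ 1 L (2 + L) ⟨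
  progression 1 1 (L + (2 + L))
    ≡⟨ cong (progression 1 1) (trans (+-suc L (suc L)) (cong suc (+-suc L L))) ⟩
  progression 1 1 (2 + (L + L)) ∎
  where
  open PermutationReasoning
  I = progression 1 1 L
  d = 3 + (L + L)

skolem⇒cyclicDifferenceFamily : ∀ n {B} → triples B ↭ skolemTarget n →
                                 IsCyclicDifferenceFamily (suc (n * 6)) B
skolem⇒cyclicDifferenceFamily n B↭T = tiling⇒cyclicDifferenceFamily B↭T
  (subst (λ e → skolemTarget n ++ map (suc e ∸_) (skolemTarget n) ↭ progression 1 1 e)
         (twice n) (skolem-tiling (3 * n)))
  where
  twice : ∀ n → 3 * n + 3 * n ≡ n * 6
  twice = solve-∀

hooked⇒cyclicDifferenceFamily : ∀ n {B} → triples B ↭ hookedTarget n →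
                                 IsCyclicDifferenceFamily (suc (suc n * 6)) B
hooked⇒cyclicDifferenceFamily n B↭T = tiling⇒cyclicDifferenceFamily B↭T
  (subst (λ e → hookedTarget n ++ map (suc e ∸_) (hookedTarget n) ↭ progression 1 1 e)
         (twice n) (hooked-tiling (2 + 3 * n)))
  where
  twice : ∀ n → 2 + ((2 + 3 * n) + (2 + 3 * n)) ≡ suc n * 6
  twice = solve-∀

-- Skolem-type triple systems for all orders

ladder : ℕ → ℕ → ℕ → List (ℕ × ℕ)
ladder a c zero = []
ladder a c (suc k) = (a , c + k) ∷ ladder (2 + a) c k

triples-ladder : ∀ a c k → triples (ladder a c (suc k)) ↭
  progression 2 a (suc k) ++ progression 1 c (suc k) ++ progression 1 (a + (c + k)) (suc k)
triples-ladder a c zero = ↭-reflexive (cong (λ x → a ∷ x ∷ a + (c + 0) ∷ []) (+-identityʳ c))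
triples-ladder a c (suc k) = begin
  a ∷ u ∷ v ∷ triples (ladder (2 + a) c (suc k))
    ↭⟨ prep a (prep u (prep v (triples-ladder (2 + a) c k))) ⟩
  a ∷ u ∷ v ∷ X ++ Y ++ progression 1 (2 + a + (c + k)) (suc k)
    ≡⟨ cong (λ s → a ∷ u ∷ v ∷ X ++ Y ++ progression 1 s (suc k)) next-large ⟩
  a ∷ u ∷ v ∷ X ++ Y ++ Z
    ↭⟨ prep a (prep u (shift v X (Y ++ Z))) ⟨
  a ∷ u ∷ X ++ v ∷ Y ++ Z
    ↭⟨ prep a (prep u (++⁺ˡ X (shift v Y Z))) ⟨
  a ∷ u ∷ X ++ Y ++ v ∷ Z
    ↭⟨ prep a (shift u X (Y ++ v ∷ Z)) ⟨
  a ∷ X ++ u ∷ Y ++ v ∷ Z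
    ↭⟨ prep a (++⁺ˡ X (++⁺ʳ (v ∷ Z) (last∷interval c (suc k)))) ⟩
  a ∷ X ++ progression 1 c (suc (suc k)) ++ v ∷ Z ∎
  where
  open PermutationReasoning
  u = c + suc k
  v = a + (c + suc k)
  X = progression 2 (2 + a) (suc k)
  Y = progression 1 c (suc k)
  Z = progression 1 (suc v) (suc k)
  next-large : 2 + a + (c + k) ≡ suc v
  next-large = cong suc (trans (sym (+-suc a (c + k))) (cong (a +_) (sym (+-suc c k))))

-- Affine functions b + a·t of a parameter t: the families below are given for all t at once,
-- and their correctness reduces to computations on the coefficients.
Affine : Set
Affine = ℕ × ℕ

pattern _+_·t b a = b , a

⟦_⟧ : Affine → ℕ → ℕ
⟦ b + a ·t ⟧ t = b + a * t

infixl 6 _+ᵃ_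

_+ᵃ_ : Affine → Affine → Affine
(b + a ·t) +ᵃ (c + e ·t) = (b + c) + (a + e) ·t

_*ᵃ_ : ℕ → Affine → Affine
s *ᵃ (b + a ·t) = (s * b) + (s * a) ·t

sucᵃ : Affine → Affine
sucᵃ (b + a ·t) = suc b + a ·t

sumᵃ : List Affine → Affine
sumᵃ = foldr _+ᵃ_ (0 + 0 ·t)

⟦+ᵃ⟧ : ∀ x y t → ⟦ x +ᵃ y ⟧ t ≡ ⟦ x ⟧ t + ⟦ y ⟧ t
⟦+ᵃ⟧ (b + a ·t) (c + e ·t) t = distrib b a c e t
  where
  distrib : ∀ b a c e t → b + c + (a + e) * t ≡ b + a * t + (c + e * t)
  distrib = solve-∀

⟦*ᵃ⟧ : ∀ s x t → ⟦ s *ᵃ x ⟧ t ≡ s * ⟦ x ⟧ t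
⟦*ᵃ⟧ s (b + a ·t) t = distrib s b a t
  where
  distrib : ∀ s b a t → s * b + s * a * t ≡ s * (b + a * t)
  distrib = solve-∀

⟦sucᵃ⟧ : ∀ x t → ⟦ sucᵃ x ⟧ t ≡ suc (⟦ x ⟧ t)
⟦sucᵃ⟧ (b + a ·t) t = refl

Piece : Set
Piece = ℕ × Affine × Affine

⟦_⟧ₚ : Piece → ℕ → List ℕ
⟦ s , a , k ⟧ₚ t = progression s (⟦ a ⟧ t) (⟦ k ⟧ t)

pieces : List Piece → ℕ → List ℕ
pieces ps t = concatMap (λ p → ⟦ p ⟧ₚ t) ps

pieces-++ : ∀ ps qs t → pieces (ps ++ qs) t ≡ pieces ps t ++ pieces qs t
pieces-++ ps qs t = concatMap-++ (λ p → ⟦ p ⟧ₚ t) ps qs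

_≟ₚ_ : DecidableEquality Piece
_≟ₚ_ = Product.≡-dec ℕ._≟_ (Product.≡-dec affine-≟ affine-≟)
  where
  affine-≟ : DecidableEquality Affine
  affine-≟ = Product.≡-dec ℕ._≟_ ℕ._≟_

Ladder : Set
Ladder = Affine × Affine × Affine

ladderAt : Ladder → ℕ → List (ℕ × ℕ)
ladderAt (a , c , k) t = ladder (⟦ a ⟧ t) (⟦ c ⟧ t) (suc (⟦ k ⟧ t))

ladderPieces : Ladder → List Piece
ladderPieces (a , c , k) = (2 , a , sucᵃ k) ∷ (1 , c , sucᵃ k) ∷ (1 , a +ᵃ (c +ᵃ k) , sucᵃ k) ∷ []

triples-ladderAt : ∀ ℓ t → triples (ladderAt ℓ t) ↭ pieces (ladderPieces ℓ) t
triples-ladderAt (a , c , k) t = begin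
  triples (ladder A C (suc K))
    ↭⟨ triples-ladder A C K ⟩
  progression 2 A (suc K) ++ progression 1 C (suc K) ++ progression 1 (A + (C + K)) (suc K)
    ≡⟨ cong (λ xs → progression 2 A (suc K) ++ progression 1 C (suc K) ++ xs) (sym (trans (++-identityʳ _) large)) ⟩
  progression 2 A (suc K) ++ progression 1 C (suc K) ++ progression 1 (⟦ a +ᵃ (c +ᵃ k) ⟧ t) (suc K) ++ []
    ≡⟨ cong (λ l → progression 2 A l ++ progression 1 C l ++ progression 1 (⟦ a +ᵃ (c +ᵃ k) ⟧ t) l ++ [])
            (⟦sucᵃ⟧ k t) ⟨
  pieces (ladderPieces (a , c , k)) t ∎
  where
  open PermutationReasoning
  A = ⟦ a ⟧ t
  C = ⟦ c ⟧ t
  K = ⟦ k ⟧ t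
  large : progression 1 (⟦ a +ᵃ (c +ᵃ k) ⟧ t) (suc K) ≡ progression 1 (A + (C + K)) (suc K)
  large = cong (λ x → progression 1 x (suc K)) (trans (⟦+ᵃ⟧ a (c +ᵃ k) t) (cong (A +_) (⟦+ᵃ⟧ c k t)))

chain : ℕ → Affine → List Affine → List Piece
chain s a [] = []
chain s a (k ∷ ks) = (s , a , k) ∷ chain s (a +ᵃ s *ᵃ k) ks

pieces-chain : ∀ s a ks t → pieces (chain s a ks) t ≡ progression s (⟦ a ⟧ t) (⟦ sumᵃ ks ⟧ t)
pieces-chain s a [] t = refl
pieces-chain s a (k ∷ ks) t = begin
  progression s A K ++ pieces (chain s (a +ᵃ s *ᵃ k) ks) t
    ≡⟨ cong (progression s A K ++_) (pieces-chain s (a +ᵃ s *ᵃ k) ks t) ⟩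
  progression s A K ++ progression s (⟦ a +ᵃ s *ᵃ k ⟧ t) S
    ≡⟨ cong (λ b → progression s A K ++ progression s b S) next-start ⟩
  progression s A K ++ progression s (K * s + A) S
    ≡⟨ progression-++ s A K S ⟨
  progression s A (K + S)
    ≡⟨ cong (progression s A) (⟦+ᵃ⟧ k (sumᵃ ks) t) ⟨
  progression s A (⟦ k +ᵃ sumᵃ ks ⟧ t) ∎
  where
  open ≡-Reasoning
  A = ⟦ a ⟧ t
  K = ⟦ k ⟧ t
  S = ⟦ sumᵃ ks ⟧ t
  next-start : ⟦ a +ᵃ s *ᵃ k ⟧ t ≡ K * s + A
  next-start = trans (⟦+ᵃ⟧ a (s *ᵃ k) t) (trans (cong (A +_) (trans (⟦*ᵃ⟧ s k t) (*-comm s K))) (+-comm A (K * s)))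

tilingPieces : List Affine → List Affine → List Affine → List Piece
tilingPieces odds evens runs =
  chain 2 (1 + 0 ·t) odds ++ chain 2 (2 + 0 ·t) evens ++ chain 1 (sucᵃ (sumᵃ odds +ᵃ sumᵃ evens)) runs

pieces-tiling : ∀ odds evens runs → sumᵃ odds ≡ sumᵃ evens ⊎ sumᵃ odds ≡ sucᵃ (sumᵃ evens) → ∀ t →
  pieces (tilingPieces odds evens runs) t ↭ progression 1 1 (⟦ sumᵃ odds +ᵃ sumᵃ evens +ᵃ sumᵃ runs ⟧ t)
pieces-tiling odds evens runs balanced t = begin
  pieces (Odds ++ Evens ++ Runs) t
    ≡⟨ trans (pieces-++ Odds (Evens ++ Runs) t) (cong (pieces Odds t ++_) (pieces-++ Evens Runs t)) ⟩
  pieces Odds t ++ pieces Evens t ++ pieces Runs t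
    ≡⟨ cong₂ (λ xs ys → xs ++ ys ++ pieces Runs t) (pieces-chain 2 (1 + 0 ·t) odds t) (pieces-chain 2 (2 + 0 ·t) evens t) ⟩
  progression 2 1 O ++ progression 2 2 E ++ pieces Runs t
    ≡⟨ cong (λ xs → progression 2 1 O ++ progression 2 2 E ++ xs) (pieces-chain 1 _ runs t) ⟩
  progression 2 1 O ++ progression 2 2 E ++ progression 1 (⟦ sucᵃ (sumᵃ odds +ᵃ sumᵃ evens) ⟧ t) R
    ≡⟨ cong (λ x → progression 2 1 O ++ progression 2 2 E ++ progression 1 x R)
            (trans (⟦sucᵃ⟧ (sumᵃ odds +ᵃ sumᵃ evens) t) (cong suc (⟦+ᵃ⟧ (sumᵃ odds) (sumᵃ evens) t))) ⟩
  progression 2 1 O ++ progression 2 2 E ++ progression 1 (suc (O + E)) R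
    ≡⟨ ++-assoc (progression 2 1 O) _ _ ⟨
  (progression 2 1 O ++ progression 2 2 E) ++ progression 1 (suc (O + E)) R
    ↭⟨ ++⁺ʳ _ (interleave-balanced 1 balanced-at-t) ⟨
  progression 1 1 (O + E) ++ progression 1 (1 + (O + E)) R
    ≡⟨ interval-++ 1 (O + E) R ⟨
  progression 1 1 (O + E + R)
    ≡⟨ cong (progression 1 1) total ⟨
  progression 1 1 (⟦ sumᵃ odds +ᵃ sumᵃ evens +ᵃ sumᵃ runs ⟧ t) ∎
  where
  open PermutationReasoning
  Odds = chain 2 (1 + 0 ·t) odds
  Evens = chain 2 (2 + 0 ·t) evens
  Runs = chain 1 (sucᵃ (sumᵃ odds +ᵃ sumᵃ evens)) runs
  O = ⟦ sumᵃ odds ⟧ t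
  E = ⟦ sumᵃ evens ⟧ t
  R = ⟦ sumᵃ runs ⟧ t
  total : ⟦ sumᵃ odds +ᵃ sumᵃ evens +ᵃ sumᵃ runs ⟧ t ≡ O + E + R
  total = trans (⟦+ᵃ⟧ (sumᵃ odds +ᵃ sumᵃ evens) (sumᵃ runs) t)
                (cong (_+ R) (⟦+ᵃ⟧ (sumᵃ odds) (sumᵃ evens) t))
  balanced-at-t : O ≡ E ⊎ O ≡ suc E
  balanced-at-t = Sum.map (cong (λ x → ⟦ x ⟧ t))
                          (λ eq → trans (cong (λ x → ⟦ x ⟧ t) eq) (⟦sucᵃ⟧ (sumᵃ evens) t)) balanced

open PermutationCheck _≟ₚ_ using (isPermutation; isPermutation-sound)

-- The odd and the even
-- numbers up to S = Σ odds + Σ evens are cut into consecutive step-2 progressions of lengths odds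
-- and evens, {S + 1, …, L} into consecutive intervals of lengths runs, and the resulting pieces are
-- compared with those of the ladders by computation.
record TilingCertificate (L : Affine) (extra : List Piece) : Set where
  field
    ladders : List Ladder
    odds evens runs : List Affine
    balanced : sumᵃ odds ≡ sumᵃ evens ⊎ sumᵃ odds ≡ sucᵃ (sumᵃ evens)
    total : sumᵃ odds +ᵃ sumᵃ evens +ᵃ sumᵃ runs ≡ L
    tiles : T (isPermutation (concatMap ladderPieces ladders) (tilingPieces odds evens runs ++ extra))

  blocksAt : ℕ → List (ℕ × ℕ)
  blocksAt t = concatMap (λ ℓ → ladderAt ℓ t) ladders

  triples-blocksAt : ∀ t → triples (blocksAt t) ↭ progression 1 1 (⟦ L ⟧ t) ++ pieces extra t
  triples-blocksAt t = begin
    triples (blocksAt t)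
      ≡⟨ concatMap-concatMap triple (λ ℓ → ladderAt ℓ t) ladders ⟩
    concatMap (λ ℓ → triples (ladderAt ℓ t)) ladders
      ↭⟨ concatMap-cong-↭ (λ ℓ → triples-ladderAt ℓ t) ladders ⟩
    concatMap (λ ℓ → pieces (ladderPieces ℓ) t) ladders
      ≡⟨ concatMap-concatMap (λ p → ⟦ p ⟧ₚ t) ladderPieces ladders ⟨
    pieces (concatMap ladderPieces ladders) t
      ↭⟨ concatMap⁺ (λ p → ⟦ p ⟧ₚ t) (isPermutation-sound (concatMap ladderPieces ladders) _ tiles) ⟩
    pieces (tilingPieces odds evens runs ++ extra) t
      ≡⟨ pieces-++ (tilingPieces odds evens runs) extra t ⟩
    pieces (tilingPieces odds evens runs) t ++ pieces extra t
      ↭⟨ ++⁺ʳ (pieces extra t) (pieces-tiling odds evens runs balanced t) ⟩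
    progression 1 1 (⟦ sumᵃ odds +ᵃ sumᵃ evens +ᵃ sumᵃ runs ⟧ t) ++ pieces extra t
      ≡⟨ cong (λ L → progression 1 1 (⟦ L ⟧ t) ++ pieces extra t) total ⟩
    progression 1 1 (⟦ L ⟧ t) ++ pieces extra t ∎
    where open PermutationReasoning

SkolemCertificate : Affine → Set
SkolemCertificate n = TilingCertificate (3 *ᵃ n) []

HookedCertificate : Affine → Set
HookedCertificate n =
  TilingCertificate (sucᵃ (sucᵃ (3 *ᵃ n))) [ 1 , sucᵃ (sucᵃ (sucᵃ (sucᵃ (3 *ᵃ n)))) , 1 + 0 ·t ]

skolem-certified : ∀ n → SkolemCertificate n → ∀ t → CyclicDifferenceFamily (suc (⟦ n ⟧ t * 6))
skolem-certified n cert t = blocksAt t , skolem⇒cyclicDifferenceFamily (⟦ n ⟧ t) (begin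
  triples (blocksAt t)                ↭⟨ triples-blocksAt t ⟩
  progression 1 1 (⟦ 3 *ᵃ n ⟧ t) ++ [] ≡⟨ ++-identityʳ _ ⟩
  progression 1 1 (⟦ 3 *ᵃ n ⟧ t)      ≡⟨ cong (progression 1 1) (⟦*ᵃ⟧ 3 n t) ⟩
  skolemTarget (⟦ n ⟧ t)              ∎)
  where
  open TilingCertificate cert
  open PermutationReasoning

hooked-certified : ∀ n → HookedCertificate n → ∀ t → CyclicDifferenceFamily (suc (suc (⟦ n ⟧ t) * 6))
hooked-certified n@(_ + _ ·t) cert t = blocksAt t , hooked⇒cyclicDifferenceFamily (⟦ n ⟧ t) (begin
  triples (blocksAt t)
    ↭⟨ triples-blocksAt t ⟩
  progression 1 1 (2 + ⟦ 3 *ᵃ n ⟧ t) ++ [ 4 + ⟦ 3 *ᵃ n ⟧ t ]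
    ≡⟨ cong (λ x → progression 1 1 (2 + x) ++ [ 4 + x ]) (⟦*ᵃ⟧ 3 n t) ⟩
  hookedTarget (⟦ n ⟧ t) ∎)
  where
  open TilingCertificate cert
  open PermutationReasoning

byResidueMod4 : {P : ℕ → Set} → (∀ t → P (t * 4)) → (∀ t → P (1 + t * 4)) →
                (∀ t → P (2 + t * 4)) → (∀ t → P (3 + t * 4)) → ∀ n → P n
byResidueMod4 p₀ p₁ p₂ p₃ 0 = p₀ 0
byResidueMod4 p₀ p₁ p₂ p₃ 1 = p₁ 0
byResidueMod4 p₀ p₁ p₂ p₃ 2 = p₂ 0
byResidueMod4 p₀ p₁ p₂ p₃ 3 = p₃ 0
byResidueMod4 {P} p₀ p₁ p₂ p₃ (suc (suc (suc (suc n)))) =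
  byResidueMod4 {λ n → P (4 + n)} (p₀ ∘ suc) (p₁ ∘ suc) (p₂ ∘ suc) (p₃ ∘ suc) n

certificate₀ : SkolemCertificate (12 + 4 ·t)
certificate₀ = record
  { ladders = (7 + 2 ·t , 13 + 4 ·t , 1 + 1 ·t) ∷ (1 + 0 ·t , 15 + 5 ·t , 0 + 0 ·t)
            ∷ (3 + 0 ·t , 17 + 5 ·t , 0 + 1 ·t) ∷ (5 + 2 ·t , 18 + 6 ·t , 0 + 0 ·t)
            ∷ (11 + 4 ·t , 19 + 6 ·t , 0 + 0 ·t) ∷ (2 + 0 ·t , 24 + 8 ·t , 5 + 2 ·t) ∷ []
  ; odds  = 1 + 0 ·t ∷ 1 + 1 ·t ∷ 1 + 0 ·t ∷ 2 + 1 ·t ∷ 1 + 0 ·t ∷ []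
  ; evens = 6 + 2 ·t ∷ []
  ; runs  = 2 + 1 ·t ∷ 1 + 0 ·t ∷ 1 + 0 ·t ∷ 1 + 1 ·t ∷ 1 + 0 ·t ∷ 1 + 0 ·t ∷ 1 + 1 ·t ∷ 2 + 1 ·t
          ∷ 1 + 0 ·t ∷ 6 + 2 ·t ∷ 1 + 0 ·t ∷ 6 + 2 ·t ∷ []
  ; balanced = inj₁ refl
  ; total = refl
  ; tiles = tt
  }

certificate₁ : SkolemCertificate (13 + 4 ·t)
certificate₁ = record
  { ladders = (3 + 0 ·t , 14 + 4 ·t , 5 + 2 ·t) ∷ (8 + 2 ·t , 20 + 6 ·t , 0 + 0 ·t)
            ∷ (12 + 4 ·t , 21 + 6 ·t , 0 + 0 ·t) ∷ (10 + 2 ·t , 29 + 8 ·t , 0 + 1 ·t)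
            ∷ (2 + 0 ·t , 30 + 9 ·t , 2 + 1 ·t) ∷ (1 + 0 ·t , 37 + 11 ·t , 0 + 0 ·t) ∷ []
  ; odds  = 1 + 0 ·t ∷ 6 + 2 ·t ∷ []
  ; evens = 3 + 1 ·t ∷ 1 + 0 ·t ∷ 1 + 1 ·t ∷ 1 + 0 ·t ∷ []
  ; runs  = 6 + 2 ·t ∷ 1 + 0 ·t ∷ 1 + 0 ·t ∷ 6 + 2 ·t ∷ 1 + 0 ·t ∷ 1 + 1 ·t ∷ 3 + 1 ·t ∷ 1 + 0 ·t
          ∷ 3 + 1 ·t ∷ 1 + 0 ·t ∷ 1 + 0 ·t ∷ 1 + 1 ·t ∷ []
  ; balanced = inj₂ refl
  ; total = refl
  ; tiles = tt
  }

certificate₂ : HookedCertificate (13 + 4 ·t)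
certificate₂ = record
  { ladders = (2 + 0 ·t , 15 + 4 ·t , 6 + 2 ·t) ∷ (13 + 4 ·t , 22 + 6 ·t , 0 + 0 ·t)
            ∷ (11 + 2 ·t , 30 + 8 ·t , 0 + 1 ·t) ∷ (3 + 0 ·t , 31 + 9 ·t , 2 + 1 ·t)
            ∷ (9 + 2 ·t , 34 + 10 ·t , 0 + 0 ·t) ∷ (1 + 0 ·t , 39 + 11 ·t , 0 + 0 ·t) ∷ []
  ; odds  = 1 + 0 ·t ∷ 3 + 1 ·t ∷ 1 + 0 ·t ∷ 1 + 1 ·t ∷ 1 + 0 ·t ∷ []
  ; evens = 7 + 2 ·t ∷ []
  ; runs  = 7 + 2 ·t ∷ 1 + 0 ·t ∷ 7 + 2 ·t ∷ 1 + 1 ·t ∷ 3 + 1 ·t ∷ 1 + 0 ·t ∷ 1 + 0 ·t ∷ 3 + 1 ·t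
          ∷ 1 + 0 ·t ∷ 1 + 0 ·t ∷ 1 + 1 ·t ∷ []
  ; balanced = inj₁ refl
  ; total = refl
  ; tiles = tt
  }

certificate₃ : HookedCertificate (14 + 4 ·t)
certificate₃ = record
  { ladders = (2 + 0 ·t , 16 + 4 ·t , 6 + 2 ·t) ∷ (15 + 4 ·t , 23 + 6 ·t , 0 + 0 ·t)
            ∷ (9 + 2 ·t , 31 + 8 ·t , 2 + 1 ·t) ∷ (1 + 0 ·t , 34 + 9 ·t , 0 + 0 ·t)
            ∷ (3 + 0 ·t , 36 + 9 ·t , 1 + 1 ·t) ∷ (7 + 2 ·t , 39 + 10 ·t , 0 + 0 ·t) ∷ []
  ; odds  = 1 + 0 ·t ∷ 2 + 1 ·t ∷ 1 + 0 ·t ∷ 3 + 1 ·t ∷ 1 + 0 ·t ∷ []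
  ; evens = 7 + 2 ·t ∷ []
  ; runs  = 7 + 2 ·t ∷ 1 + 0 ·t ∷ 7 + 2 ·t ∷ 3 + 1 ·t ∷ 1 + 0 ·t ∷ 1 + 0 ·t ∷ 2 + 1 ·t ∷ 1 + 0 ·t
          ∷ 1 + 0 ·t ∷ 2 + 1 ·t ∷ 3 + 1 ·t ∷ []
  ; balanced = inj₂ refl
  ; total = refl
  ; tiles = tt
  }

private
  module ℕ-Permutation = PermutationCheck ℕ._≟_

skolem-checked : ∀ n B → T (ℕ-Permutation.isPermutation (triples B) (skolemTarget n)) →
                 CyclicDifferenceFamily (suc (n * 6))
skolem-checked n B ok = B , skolem⇒cyclicDifferenceFamily n (ℕ-Permutation.isPermutation-sound _ _ ok)

hooked-checked : ∀ n B → T (ℕ-Permutation.isPermutation (triples B) (hookedTarget n)) →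
                 CyclicDifferenceFamily (suc (suc n * 6))
hooked-checked n B ok = B , hooked⇒cyclicDifferenceFamily n (ℕ-Permutation.isPermutation-sound _ _ ok)

cyclicDifferenceFamily : ∀ n → CyclicDifferenceFamily (suc (n * 6))
cyclicDifferenceFamily = byResidueMod4 residue₀ residue₁ residue₂ residue₃
  where
  residue₀ : ∀ t → CyclicDifferenceFamily (suc (t * 4 * 6))
  residue₀ 0 = [] , [] , ↭-refl
  residue₀ 1 = skolem-checked 4 ((4 , 5) ∷ (2 , 6) ∷ (3 , 7) ∷ (1 , 11) ∷ []) tt
  residue₀ 2 = skolem-checked 8 ((8 , 9) ∷ (6 , 10) ∷ (4 , 11) ∷ (7 , 12) ∷ (1 , 13) ∷ (5 , 18) ∷ (2 , 20)
                                  ∷ (3 , 21) ∷ []) tt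
  residue₀ (suc (suc (suc t))) =
    subst (λ x → CyclicDifferenceFamily (suc ((12 + x) * 6))) (*-comm 4 t) (skolem-certified (12 + 4 ·t) certificate₀ t)
  residue₁ : ∀ t → CyclicDifferenceFamily (suc ((1 + t * 4) * 6))
  residue₁ 0 = skolem-checked 1 ((1 , 2) ∷ []) tt
  residue₁ 1 = skolem-checked 5 ((5 , 6) ∷ (2 , 7) ∷ (4 , 8) ∷ (3 , 10) ∷ (1 , 14) ∷ []) tt
  residue₁ 2 = skolem-checked 9 ((9 , 10) ∷ (7 , 11) ∷ (8 , 12) ∷ (4 , 13) ∷ (2 , 14) ∷ (6 , 15) ∷ (5 , 22)
                                  ∷ (3 , 23) ∷ (1 , 24) ∷ []) tt
  residue₁ (suc (suc (suc t))) =
    subst (λ x → CyclicDifferenceFamily (suc ((13 + x) * 6))) (*-comm 4 t) (skolem-certified (13 + 4 ·t) certificate₁ t)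
  residue₂ : ∀ t → CyclicDifferenceFamily (suc ((2 + t * 4) * 6))
  residue₂ 0 = hooked-checked 1 ((1 , 3) ∷ (2 , 5) ∷ []) tt
  residue₂ 1 = hooked-checked 5 ((6 , 7) ∷ (4 , 8) ∷ (5 , 9) ∷ (1 , 10) ∷ (2 , 15) ∷ (3 , 16) ∷ []) tt
  residue₂ 2 = hooked-checked 9 ((10 , 11) ∷ (8 , 12) ∷ (9 , 13) ∷ (5 , 14) ∷ (2 , 15) ∷ (7 , 16) ∷ (6 , 18)
                                   ∷ (4 , 25) ∷ (1 , 26) ∷ (3 , 28) ∷ []) tt
  residue₂ (suc (suc (suc t))) =
    subst (λ x → CyclicDifferenceFamily (suc ((14 + x) * 6))) (*-comm 4 t) (hooked-certified (13 + 4 ·t) certificate₂ t)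
  residue₃ : ∀ t → CyclicDifferenceFamily (suc ((3 + t * 4) * 6))
  residue₃ 0 = hooked-checked 2 ((3 , 4) ∷ (1 , 5) ∷ (2 , 8) ∷ []) tt
  residue₃ 1 = hooked-checked 6 ((7 , 8) ∷ (5 , 9) ∷ (6 , 10) ∷ (1 , 11) ∷ (4 , 13) ∷ (2 , 18) ∷ (3 , 19) ∷ []) tt
  residue₃ 2 = hooked-checked 10 ((11 , 12) ∷ (9 , 13) ∷ (10 , 14) ∷ (6 , 15) ∷ (4 , 16) ∷ (8 , 17) ∷ (1 , 18)
                                    ∷ (5 , 26) ∷ (7 , 27) ∷ (2 , 28) ∷ (3 , 29) ∷ []) tt
  residue₃ (suc (suc (suc t))) =
    subst (λ x → CyclicDifferenceFamily (suc ((15 + x) * 6))) (*-comm 4 t) (hooked-certified (14 + 4 ·t) certificate₃ t)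

-- The group ℤ₂^m and its orthomorphisms

infixl 6 _⊕_

_⊕_ : ∀ {m} → Vec Bool m → Vec Bool m → Vec Bool m
_⊕_ = zipWith _xor_

0ᵥ : ∀ {m} → Vec Bool m
0ᵥ {m} = replicate m false

⊕-identityˡ : ∀ {m} (v : Vec Bool m) → 0ᵥ ⊕ v ≡ v
⊕-identityˡ = Vec.zipWith-identityˡ Bool.xor-identityˡ

⊕-identityʳ : ∀ {m} (v : Vec Bool m) → v ⊕ 0ᵥ ≡ v
⊕-identityʳ = Vec.zipWith-identityʳ Bool.xor-identityʳ

⊕-comm : ∀ {m} (u v : Vec Bool m) → u ⊕ v ≡ v ⊕ u
⊕-comm = Vec.zipWith-comm Bool.xor-comm

⊕-self : ∀ {m} (v : Vec Bool m) → v ⊕ v ≡ 0ᵥ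
⊕-self [] = refl
⊕-self (b ∷ v) = cong₂ _∷_ (Bool.xor-same b) (⊕-self v)

_≟ᵥ_ : ∀ {m} → DecidableEquality (Vec Bool m)
_≟ᵥ_ = Vec.≡-dec Bool._≟_

vectors : ∀ m → List (Vec Bool m)
vectors zero = [ [] ]
vectors (suc m) = map (true ∷_) (vectors m) ++ map (false ∷_) (vectors m)

∈-vectors : ∀ {m} (v : Vec Bool m) → v ∈ vectors m
∈-vectors [] = here refl
∈-vectors (true ∷ v) = ∈-++⁺ˡ (∈-map⁺ (true ∷_) (∈-vectors v))
∈-vectors (false ∷ v) = ∈-++⁺ʳ (map (true ∷_) _) (∈-map⁺ (false ∷_) (∈-vectors v))

vectors-unique : ∀ m → Unique (vectors m)
vectors-unique zero = [] ∷ []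
vectors-unique (suc m) = Unique.++⁺ (Unique.map⁺ Vec.∷-injectiveʳ (vectors-unique m))
                                    (Unique.map⁺ Vec.∷-injectiveʳ (vectors-unique m))
                                    heads-differ
  where
  heads-differ : Disjoint (map (true ∷_) (vectors m)) (map (false ∷_) (vectors m))
  heads-differ (t∈ , f∈) with ∈-map⁻ (true ∷_) t∈ | ∈-map⁻ (false ∷_) f∈
  ... | _ , _ , refl | _ , _ , ()

length-vectors : ∀ m → length (vectors m) ≡ 2 ^ m
length-vectors zero = refl
length-vectors (suc m) = begin
  length (map (true ∷_) (vectors m) ++ map (false ∷_) (vectors m))
    ≡⟨ length-++ (map (true ∷_) (vectors m)) ⟩
  length (map (true ∷_) (vectors m)) + length (map (false ∷_) (vectors m))
    ≡⟨ cong₂ _+_ (length-map _ (vectors m)) (length-map _ (vectors m)) ⟩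
  length (vectors m) + length (vectors m)
    ≡⟨ cong₂ _+_ (length-vectors m) (trans (length-vectors m) (sym (+-identityʳ (2 ^ m)))) ⟩
  2 ^ suc m ∎
  where open ≡-Reasoning

by-exhaustion : ∀ {m} {P : Vec Bool m → Set} → All P (vectors m) → ∀ v → P v
by-exhaustion all-P v = All.lookup all-P (∈-vectors v)

module _ {m : ℕ} where
  open Multiplicity (_≟ᵥ_ {m})

  count-vectors : ∀ v → count v (vectors m) ≡ 1
  count-vectors v = count-unique (vectors-unique m) (∈-vectors v)

  PermutesVectors : (Vec Bool m → Vec Bool m) → Set
  PermutesVectors f = ∀ v → count v (map f (vectors m)) ≡ 1

  PermutesVectors-resp-≗ : ∀ {f g} → (∀ v → f v ≡ g v) → PermutesVectors g → PermutesVectors f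
  PermutesVectors-resp-≗ f≗g g-permutes v = trans (cong (count v) (map-cong f≗g (vectors m))) (g-permutes v)

  inverse⇒permutesVectors : ∀ {f g} → StrictlyInverseˡ _≡_ f g → StrictlyInverseʳ _≡_ f g → PermutesVectors f
  inverse⇒permutesVectors {f} {g} f∘g g∘f v = begin
    count v (map f (vectors m))         ≡⟨ cong (λ u → count u (map f (vectors m))) (f∘g v) ⟨
    count (f (g v)) (map f (vectors m)) ≡⟨ count-map-injective _≟ᵥ_ _≟ᵥ_ f-injective (g v) (vectors m) ⟩
    count (g v) (vectors m)             ≡⟨ count-vectors (g v) ⟩
    1                                   ∎
    where
    open ≡-Reasoning
    f-injective : ∀ {u w} → f u ≡ f w → u ≡ w
    f-injective {u} {w} fu≡fw = trans (sym (g∘f u)) (trans (cong g fu≡fw) (g∘f w))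

nonzeroVectors : ∀ m → List (Vec Bool m)
nonzeroVectors m = filter (∁? (0ᵥ ≟ᵥ_)) (vectors m)

∈-nonzeroVectors : ∀ {m} {u : Vec Bool m} → 0ᵥ ≢ u → u ∈ nonzeroVectors m
∈-nonzeroVectors 0≢u = ∈-filter⁺ (∁? (0ᵥ ≟ᵥ_)) (∈-vectors _) 0≢u

nonzeroVectors-unique : ∀ m → Unique (nonzeroVectors m)
nonzeroVectors-unique m = Unique.filter⁺ (∁? (0ᵥ ≟ᵥ_)) (vectors-unique m)

length-nonzeroVectors : ∀ m → length (nonzeroVectors m) ≡ 2 ^ m ∸ 1
length-nonzeroVectors m = cong (_∸ 1) (begin
  1 + length (nonzeroVectors m)
    ≡⟨ cong (_+ length (nonzeroVectors m)) (count-vectors {m} 0ᵥ) ⟨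
  length (filter (0ᵥ ≟ᵥ_) (vectors m)) + length (nonzeroVectors m)
    ≡⟨ length-filter+length-filter-∁ (0ᵥ ≟ᵥ_) (vectors m) ⟩
  length (vectors m)
    ≡⟨ length-vectors m ⟩
  2 ^ m ∎)
  where open ≡-Reasoning

record Orthomorphism (m : ℕ) : Set where
  field
    σ σ⁻¹ τ⁻¹ : Vec Bool m → Vec Bool m
    σ-inverseˡ : StrictlyInverseˡ _≡_ σ σ⁻¹
    σ-inverseʳ : StrictlyInverseʳ _≡_ σ σ⁻¹
    τ-inverseˡ : StrictlyInverseˡ _≡_ (λ v → v ⊕ σ v) τ⁻¹
    τ-inverseʳ : StrictlyInverseʳ _≡_ (λ v → v ⊕ σ v) τ⁻¹

-- Multiplication by x in 𝔽₄ = 𝔽₂[x]/(x² + x + 1), in the basis 1, x.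
orthomorphism₂ : Orthomorphism 2
orthomorphism₂ = record
  { σ   = λ { (a ∷ b ∷ []) → b ∷ (a xor b) ∷ [] }
  ; σ⁻¹ = λ { (a ∷ b ∷ []) → (a xor b) ∷ a ∷ [] }
  ; τ⁻¹ = λ { (a ∷ b ∷ []) → b ∷ (a xor b) ∷ [] }
  ; σ-inverseˡ = by-exhaustion (refl ∷ refl ∷ refl ∷ refl ∷ [])
  ; σ-inverseʳ = by-exhaustion (refl ∷ refl ∷ refl ∷ refl ∷ [])
  ; τ-inverseˡ = by-exhaustion (refl ∷ refl ∷ refl ∷ refl ∷ [])
  ; τ-inverseʳ = by-exhaustion (refl ∷ refl ∷ refl ∷ refl ∷ [])
  }

-- Multiplication by x in 𝔽₈ = 𝔽₂[x]/(x³ + x + 1), in the basis 1, x, x².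
orthomorphism₃ : Orthomorphism 3
orthomorphism₃ = record
  { σ   = λ { (a ∷ b ∷ c ∷ []) → c ∷ (a xor c) ∷ b ∷ [] }
  ; σ⁻¹ = λ { (a ∷ b ∷ c ∷ []) → (a xor b) ∷ c ∷ a ∷ [] }
  ; τ⁻¹ = λ { (a ∷ b ∷ c ∷ []) → (b xor c) ∷ (a xor b) ∷ (a xor (b xor c)) ∷ [] }
  ; σ-inverseˡ = by-exhaustion (refl ∷ refl ∷ refl ∷ refl ∷ refl ∷ refl ∷ refl ∷ refl ∷ [])
  ; σ-inverseʳ = by-exhaustion (refl ∷ refl ∷ refl ∷ refl ∷ refl ∷ refl ∷ refl ∷ refl ∷ [])
  ; τ-inverseˡ = by-exhaustion (refl ∷ refl ∷ refl ∷ refl ∷ refl ∷ refl ∷ refl ∷ refl ∷ [])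
  ; τ-inverseʳ = by-exhaustion (refl ∷ refl ∷ refl ∷ refl ∷ refl ∷ refl ∷ refl ∷ refl ∷ [])
  }

take-++ : ∀ {A : Set} {k m} (xs : Vec A k) (ys : Vec A m) → take k (xs ++ᵥ ys) ≡ xs
take-++ [] ys = refl
take-++ (x ∷ xs) ys = cong (x ∷_) (take-++ xs ys)

drop-++ : ∀ {A : Set} {k m} (xs : Vec A k) (ys : Vec A m) → drop k (xs ++ᵥ ys) ≡ ys
drop-++ [] ys = refl
drop-++ (x ∷ xs) ys = drop-++ xs ys

module _ {k m : ℕ} where

  blockwise : (Vec Bool k → Vec Bool k) → (Vec Bool m → Vec Bool m) → Vec Bool (k + m) → Vec Bool (k + m)
  blockwise f g v = f (take k v) ++ᵥ g (drop k v)

  blockwise-inverseˡ : ∀ {f₁ g₁ f₂ g₂} → StrictlyInverseˡ _≡_ f₁ g₁ → StrictlyInverseˡ _≡_ f₂ g₂ →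
                       StrictlyInverseˡ _≡_ (blockwise f₁ f₂) (blockwise g₁ g₂)
  blockwise-inverseˡ {f₁} {g₁} {f₂} {g₂} inverse₁ inverse₂ v = begin
    f₁ (take k (g₁ (take k v) ++ᵥ g₂ (drop k v))) ++ᵥ f₂ (drop k (g₁ (take k v) ++ᵥ g₂ (drop k v)))
      ≡⟨ cong₂ (λ a b → f₁ a ++ᵥ f₂ b) (take-++ (g₁ (take k v)) _) (drop-++ (g₁ (take k v)) _) ⟩
    f₁ (g₁ (take k v)) ++ᵥ f₂ (g₂ (drop k v))
      ≡⟨ cong₂ _++ᵥ_ (inverse₁ (take k v)) (inverse₂ (drop k v)) ⟩
    take k v ++ᵥ drop k v
      ≡⟨ Vec.take++drop≡id k v ⟩
    v ∎
    where open ≡-Reasoning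

  ⊕-blockwise : ∀ (f : Vec Bool k → Vec Bool k) (g : Vec Bool m → Vec Bool m) v →
                v ⊕ blockwise f g v ≡ blockwise (λ u → u ⊕ f u) (λ w → w ⊕ g w) v
  ⊕-blockwise f g v = begin
    v ⊕ (f (take k v) ++ᵥ g (drop k v))
      ≡⟨ cong (_⊕ (f (take k v) ++ᵥ g (drop k v))) (Vec.take++drop≡id k v) ⟨
    (take k v ++ᵥ drop k v) ⊕ (f (take k v) ++ᵥ g (drop k v))
      ≡⟨ Vec.zipWith-++ _xor_ (take k v) (drop k v) (f (take k v)) (g (drop k v)) ⟩
    (take k v ⊕ f (take k v)) ++ᵥ (drop k v ⊕ g (drop k v)) ∎
    where open ≡-Reasoning

_⊞_ : ∀ {k m} → Orthomorphism k → Orthomorphism m → Orthomorphism (k + m)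
o₁ ⊞ o₂ = record
  { σ   = blockwise O₁.σ O₂.σ
  ; σ⁻¹ = blockwise O₁.σ⁻¹ O₂.σ⁻¹
  ; τ⁻¹ = blockwise O₁.τ⁻¹ O₂.τ⁻¹
  ; σ-inverseˡ = blockwise-inverseˡ {f₁ = O₁.σ} {f₂ = O₂.σ} O₁.σ-inverseˡ O₂.σ-inverseˡ
  ; σ-inverseʳ = blockwise-inverseˡ {f₁ = O₁.σ⁻¹} {f₂ = O₂.σ⁻¹} O₁.σ-inverseʳ O₂.σ-inverseʳ
  ; τ-inverseˡ = λ v → trans (⊕-blockwise O₁.σ O₂.σ _)
      (blockwise-inverseˡ {f₁ = λ u → u ⊕ O₁.σ u} {f₂ = λ u → u ⊕ O₂.σ u} O₁.τ-inverseˡ O₂.τ-inverseˡ v)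
  ; τ-inverseʳ = λ v → trans (cong (blockwise O₁.τ⁻¹ O₂.τ⁻¹) (⊕-blockwise O₁.σ O₂.σ v))
      (blockwise-inverseˡ {f₁ = O₁.τ⁻¹} {f₂ = O₂.τ⁻¹} O₁.τ-inverseʳ O₂.τ-inverseʳ v)
  }
  where
  module O₁ = Orthomorphism o₁
  module O₂ = Orthomorphism o₂

orthomorphism : ∀ k → Orthomorphism (2 + k)
orthomorphism zero = orthomorphism₂
orthomorphism (suc zero) = orthomorphism₃
orthomorphism (suc (suc k)) = orthomorphism₂ ⊞ orthomorphism k

-- Lifting to ℤ₂^m × ℤ_d

module ModularSubtraction (d : ℕ) .{{_ : NonZero d}} where

  _⊖_ : Fin d → Fin d → Fin d
  a ⊖ b = (toℕ a + toℕ ((d ∸ toℕ b) mod d)) mod d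

  toℕ-mod : ∀ x → toℕ (x mod d) ≡ x % d
  toℕ-mod x = toℕ-fromℕ< _

  toℕ-mod< : ∀ {x} → x < d → toℕ (x mod d) ≡ x
  toℕ-mod< {x} x<d = trans (toℕ-mod x) (m<n⇒m%n≡m x<d)

  toℕ-⊖ : ∀ {x y} → x < d → y < d → toℕ ((x mod d) ⊖ (y mod d)) ≡ (x + (d ∸ y)) % d
  toℕ-⊖ {x} {y} x<d y<d = begin
    toℕ ((toℕ (x mod d) + toℕ ((d ∸ toℕ (y mod d)) mod d)) mod d)
      ≡⟨ toℕ-mod _ ⟩
    (toℕ (x mod d) + toℕ ((d ∸ toℕ (y mod d)) mod d)) % d
      ≡⟨ cong₂ (λ a b → (a + toℕ ((d ∸ b) mod d)) % d) (toℕ-mod< x<d) (toℕ-mod< y<d) ⟩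
    (x + toℕ ((d ∸ y) mod d)) % d
      ≡⟨ cong (λ a → (x + a) % d) (toℕ-mod (d ∸ y)) ⟩
    (x + (d ∸ y) % d) % d
      ≡⟨ %-distribˡ-+ x ((d ∸ y) % d) d ⟩
    (x % d + (d ∸ y) % d % d) % d
      ≡⟨ cong (λ a → (x % d + a) % d) (m%n%n≡m%n (d ∸ y) d) ⟩
    (x % d + (d ∸ y) % d) % d
      ≡⟨ %-distribˡ-+ x (d ∸ y) d ⟨
    (x + (d ∸ y)) % d ∎
    where open ≡-Reasoning

  toℕ-⊖-≥ : ∀ {x y} → y ≤ x → x < d → toℕ ((x mod d) ⊖ (y mod d)) ≡ x ∸ y
  toℕ-⊖-≥ {x} {y} y≤x x<d = begin
    toℕ ((x mod d) ⊖ (y mod d)) ≡⟨ toℕ-⊖ x<d y<d ⟩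
    (x + (d ∸ y)) % d           ≡⟨ cong (_% d) (+-∸-assoc x (<⇒≤ y<d)) ⟨
    (x + d ∸ y) % d             ≡⟨ cong (_% d) (+-∸-comm d y≤x) ⟩
    (x ∸ y + d) % d             ≡⟨ [m+n]%n≡m%n (x ∸ y) d ⟩
    (x ∸ y) % d                 ≡⟨ m<n⇒m%n≡m (≤-<-trans (m∸n≤m x y) x<d) ⟩
    x ∸ y                       ∎
    where
    open ≡-Reasoning
    y<d = ≤-<-trans y≤x x<d

  toℕ-⊖-< : ∀ {x y} → x < y → y < d → toℕ ((x mod d) ⊖ (y mod d)) ≡ d ∸ (y ∸ x)
  toℕ-⊖-< {x} {y} x<y y<d = begin
    toℕ ((x mod d) ⊖ (y mod d))  ≡⟨ toℕ-⊖ (<-trans x<y y<d) y<d ⟩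
    (x + (d ∸ y)) % d            ≡⟨ cong (_% d) (+-∸-assoc x (<⇒≤ y<d)) ⟨
    (x + d ∸ y) % d              ≡⟨ cong (λ z → (x + d ∸ z) % d) (m+[n∸m]≡n (<⇒≤ x<y)) ⟨
    (x + d ∸ (x + (y ∸ x))) % d  ≡⟨ cong (_% d) ([m+n]∸[m+o]≡n∸o x d (y ∸ x)) ⟩
    (d ∸ (y ∸ x)) % d            ≡⟨ m<n⇒m%n≡m (∸-monoʳ-< (m<n⇒0<n∸m x<y) (≤-trans (m∸n≤m y x) (<⇒≤ y<d))) ⟩
    d ∸ (y ∸ x)                  ∎
    where open ≡-Reasoning

module Lifting {m d′ : ℕ} (orth : Orthomorphism (suc m)) where

  d : ℕ
  d = suc d′

  open Group (suc m) d hiding (count)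
  open Orthomorphism orth
  open ModularSubtraction d
  open Multiplicity _≟G_ using (count; count-↭; count-absent)
  private
    module #ℕ = Multiplicity ℕ._≟_
    module #F = Multiplicity (_≟F_ {d})
    module #V = Multiplicity (_≟ᵥ_ {suc m})

  V : Set
  V = Vec Bool (suc m)

  develop : ℕ × ℕ → V → Triple
  develop (i , p) v = (0ᵥ , 0 mod d) , (v , i mod d) , (σ v , (i + p) mod d)

  development : ℕ × ℕ → List Triple
  development b = map (develop b) (vectors (suc m))

  -- The differences of develop b v, each as its ℤ₂^m-part (a function of v) and its ℤ_d-part.
  slots : ℕ × ℕ → List ((V → V) × Fin d)
  slots (i , p) = (0ᵥ ⊕_ , o ⊖ ι) ∷ (_⊕ 0ᵥ , ι ⊖ o) ∷ ((0ᵥ ⊕_) ∘ σ , o ⊖ κ) ∷ ((_⊕ 0ᵥ) ∘ σ , κ ⊖ o)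
                ∷ ((λ v → v ⊕ σ v) , ι ⊖ κ) ∷ ((λ v → σ v ⊕ v) , κ ⊖ ι) ∷ []
    where
    o = 0 mod d
    ι = i mod d
    κ = (i + p) mod d

  ΔT-develop : ∀ b v → ΔT (develop b v) ≡ map (λ s → proj₁ s v , proj₂ s) (slots b)
  ΔT-develop (i , p) v = refl

  slots-permute : ∀ b → All (PermutesVectors ∘ proj₁) (slots b)
  slots-permute (i , p) =
    PermutesVectors-resp-≗ ⊕-identityˡ (inverse⇒permutesVectors (λ _ → refl) (λ _ → refl)) ∷
    PermutesVectors-resp-≗ ⊕-identityʳ (inverse⇒permutesVectors (λ _ → refl) (λ _ → refl)) ∷
    PermutesVectors-resp-≗ (⊕-identityˡ ∘ σ) (inverse⇒permutesVectors σ-inverseˡ σ-inverseʳ) ∷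
    PermutesVectors-resp-≗ (⊕-identityʳ ∘ σ) (inverse⇒permutesVectors σ-inverseˡ σ-inverseʳ) ∷
    inverse⇒permutesVectors τ-inverseˡ τ-inverseʳ ∷
    PermutesVectors-resp-≗ (λ v → ⊕-comm (σ v) v) (inverse⇒permutesVectors τ-inverseˡ τ-inverseʳ) ∷ []

  count-slot : ∀ {φ} z → PermutesVectors φ →
               ∀ t c → count (t , c) (map (λ v → φ v , z) (vectors (suc m))) ≡ #F.count c [ z ]
  count-slot {φ} z φ-permutes t c with c ≟F z
  ... | yes refl = begin
    count (t , c) (map (λ v → φ v , c) (vectors (suc m)))
      ≡⟨ cong (count (t , c)) (map-∘ (vectors (suc m))) ⟩
    count (t , c) (map (_, c) (map φ (vectors (suc m))))
      ≡⟨ count-map-injective _≟ᵥ_ _≟G_ (cong proj₁) t (map φ (vectors (suc m))) ⟩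
    #V.count t (map φ (vectors (suc m)))
      ≡⟨ φ-permutes t ⟩
    1 ∎
    where open ≡-Reasoning
  ... | no c≢z = count-absent (All.map⁺ (All.universal (λ v eq → c≢z (cong proj₂ eq)) (vectors (suc m))))

  slot-differences : ∀ b → IsBaseBlock d b → map toℕ (concatMap ([_] ∘ proj₂) (slots b)) ≡ differences d b
  slot-differences (i , p) (1≤i , 1≤p , i+p<d) =
    cong₂ _∷_ (toℕ-⊖-< 1≤i i<d) (cong₂ _∷_ (toℕ-⊖-≥ z≤n i<d) (cong₂ _∷_ (toℕ-⊖-< 0<i+p i+p<d)
      (cong₂ _∷_ (toℕ-⊖-≥ z≤n i+p<d) (cong₂ _∷_ (trans (toℕ-⊖-< (m<m+n i 1≤p) i+p<d) (cong (d ∸_) (m+n∸m≡n i p)))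
      (cong₂ _∷_ (trans (toℕ-⊖-≥ (m≤m+n i p) i+p<d) (m+n∸m≡n i p)) refl)))))
    where
    i<d : i < d
    i<d = ≤-<-trans (m≤m+n i p) i+p<d
    0<i+p : 0 < i + p
    0<i+p = ≤-trans 1≤i (m≤m+n i p)

  count-Δ-development : ∀ b → IsBaseBlock d b → ∀ t c →
                        count (t , c) (Δ (development b)) ≡ #ℕ.count (toℕ c) (differences d b)
  count-Δ-development b block t c = begin
    count (t , c) (concatMap ΔT (map (develop b) vs))
      ≡⟨ cong (count (t , c)) (concatMap-map ΔT (develop b) vs) ⟩
    count (t , c) (concatMap (ΔT ∘ develop b) vs)
      ≡⟨ cong (count (t , c)) (concatMap-cong (ΔT-develop b) vs) ⟩
    count (t , c) (concatMap (λ v → map (λ s → proj₁ s v , proj₂ s) (slots b)) vs)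
      ≡⟨ count-↭ (t , c) (concatMap-transpose (λ s v → proj₁ s v , proj₂ s) (slots b) vs) ⟩
    count (t , c) (concatMap (λ s → map (λ v → proj₁ s v , proj₂ s) vs) (slots b))
      ≡⟨ count-concatMap _≟G_ _≟F_ {x = t , c} {c} (λ s → map (λ v → proj₁ s v , proj₂ s) vs) ([_] ∘ proj₂)
           (All.map (λ {s} s-permutes → count-slot (proj₂ s) s-permutes t c) (slots-permute b)) ⟩
    #F.count c (concatMap ([_] ∘ proj₂) (slots b))
      ≡⟨ count-map-injective _≟F_ ℕ._≟_ toℕ-injective c (concatMap ([_] ∘ proj₂) (slots b)) ⟨
    #ℕ.count (toℕ c) (map toℕ (concatMap ([_] ∘ proj₂) (slots b)))
      ≡⟨ cong (#ℕ.count (toℕ c)) (slot-differences b block) ⟩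
    #ℕ.count (toℕ c) (differences d b) ∎
    where
    open ≡-Reasoning
    vs = vectors (suc m)

  liftedTriples : List (ℕ × ℕ) → List Triple
  liftedTriples = concatMap development

  count-Δ-liftedTriples : ∀ {B} → All (IsBaseBlock d) B → ∀ t c →
    count (t , c) (Δ (liftedTriples B)) ≡ #ℕ.count (toℕ c) (concatMap (differences d) B)
  count-Δ-liftedTriples {B} blocks t c = trans
    (cong (count (t , c)) (concatMap-concatMap ΔT development B))
    (count-concatMap _≟G_ ℕ._≟_ (Δ ∘ development) (differences d)
      (All.map (λ {b} block → count-Δ-development b block t c) blocks))

  residues-differ : ∀ {x y} {u w : V} → x < d → y < d → x ≢ y → (u , x mod d) ≢ (w , y mod d)
  residues-differ x<d y<d x≢y eq =
    x≢y (trans (sym (toℕ-mod< x<d)) (trans (cong (toℕ ∘ proj₂) eq) (toℕ-mod< y<d)))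

  develop-distinct : ∀ b → IsBaseBlock d b → ∀ v → Distinct (develop b v)
  develop-distinct (i , p) (1≤i , 1≤p , i+p<d) v =
    residues-differ 0<d i<d (<⇒≢ 1≤i) ,
    residues-differ 0<d i+p<d (<⇒≢ (≤-trans 1≤i (m≤m+n i p))) ,
    residues-differ i<d i+p<d (<⇒≢ (m<m+n i 1≤p))
    where
    0<d : 0 < d
    0<d = s≤s z≤n
    i<d : i < d
    i<d = ≤-<-trans (m≤m+n i p) i+p<d

  d-mod-d : d mod d ≡ zero
  d-mod-d = toℕ-injective (trans (toℕ-mod d) (n%n≡0 d))

  line : ∃ (0ᵥ ≢_) → Subgroup
  line (u , 0≢u) = record
    { elems   = 0G ∷ (u , zero) ∷ []
    ; unique  = ((λ eq → 0≢u (cong proj₁ eq)) ∷ []) ∷ [] ∷ []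
    ; has-0   = here refl
    ; closed+ = sum-closed
    ; closed- = negation-closed
    }
    where
    sum-closed : ∀ {x y} → x ∈ 0G ∷ (u , zero) ∷ [] → y ∈ 0G ∷ (u , zero) ∷ [] →
                 (x +G y) ∈ 0G ∷ (u , zero) ∷ []
    sum-closed (here refl)         (here refl)         = here (cong (_, zero) (⊕-identityˡ 0ᵥ))
    sum-closed (here refl)         (there (here refl)) = there (here (cong (_, zero) (⊕-identityˡ u)))
    sum-closed (there (here refl)) (here refl)         = there (here (cong (_, zero) (⊕-identityʳ u)))
    sum-closed (there (here refl)) (there (here refl)) = here (cong (_, zero) (⊕-self u))
    negation-closed : ∀ {x} → x ∈ 0G ∷ (u , zero) ∷ [] → (-G x) ∈ 0G ∷ (u , zero) ∷ []
    negation-closed (here refl)         = here (cong (0ᵥ ,_) d-mod-d)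
    negation-closed (there (here refl)) = there (here (cong (u ,_) d-mod-d))

  lines-intersect-trivially : ∀ w w′ → proj₁ w ≢ proj₁ w′ → TrivInter (line w) (line w′)
  lines-intersect-trivially _ _ _    (here x≡0)          _                 = x≡0
  lines-intersect-trivially _ _ _    (there (here _))    (here x≡0)        = x≡0
  lines-intersect-trivially _ _ u≢u′ (there (here refl)) (there (here eq)) = ⊥-elim (u≢u′ (cong proj₁ eq))

  nonzeroWitnesses : List (∃ (0ᵥ ≢_))
  nonzeroWitnesses = All.toList (All.all-filter (∁? (0ᵥ ≟ᵥ_)) (vectors (suc m)))

  nonzeroWitnesses-proj₁ : map proj₁ nonzeroWitnesses ≡ nonzeroVectors (suc m)
  nonzeroWitnesses-proj₁ = toList-proj₁ _

  spread : List Subgroup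
  spread = map line nonzeroWitnesses

  spread-type : HasType 2 (2 ^ suc m ∸ 1) spread
  spread-type = length-spread , All.map⁺ (All.universal (λ _ → refl) nonzeroWitnesses)
    where
    open ≡-Reasoning
    length-spread : length spread ≡ 2 ^ suc m ∸ 1
    length-spread = begin
      length (map line nonzeroWitnesses)  ≡⟨ length-map line nonzeroWitnesses ⟩
      length nonzeroWitnesses             ≡⟨ length-map proj₁ nonzeroWitnesses ⟨
      length (map proj₁ nonzeroWitnesses) ≡⟨ cong length nonzeroWitnesses-proj₁ ⟩
      length (nonzeroVectors (suc m))     ≡⟨ length-nonzeroVectors (suc m) ⟩
      2 ^ suc m ∸ 1                       ∎

  spread-partialSpread : PartialSpread spread
  spread-partialSpread =
    AllPairs.map⁺ (AllPairs.map (λ {w} {w′} → lines-intersect-trivially w w′)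
      (AllPairs.map⁻ (subst Unique (sym nonzeroWitnesses-proj₁) (nonzeroVectors-unique (suc m)))))

  lineThrough : ∀ {u} → u ∈ nonzeroVectors (suc m) → ∃ λ w → line w ∈ spread × proj₁ w ≡ u
  lineThrough u∈ with ∈-map⁻ proj₁ (subst (_ ∈_) (sym nonzeroWitnesses-proj₁) u∈)
  ... | w , w∈ , refl = w , ∈-map⁺ line w∈ , refl

  inUnion⇒residue-zero : ∀ {t c} → InUnion (t , c) spread → c ≡ zero
  inUnion⇒residue-zero (S , S∈ , x∈) with ∈-map⁻ line S∈
  ... | _ , _ , refl with x∈
  ...   | here eq         = cong proj₂ eq
  ...   | there (here eq) = cong proj₂ eq

  residue-zero⇒inUnion : ∀ t → InUnion (t , zero) spread
  residue-zero⇒inUnion t with 0ᵥ ≟ᵥ t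
  ... | yes refl with lineThrough (∈-nonzeroVectors {u = true ∷ 0ᵥ} (λ ()))
  ...   | w , w∈ , _ = line w , w∈ , here refl
  residue-zero⇒inUnion t | no 0≢t with lineThrough (∈-nonzeroVectors 0≢t)
  ... | w , w∈ , refl = line w , w∈ , there (here refl)

  liftedFamily : ∀ {B} → IsCyclicDifferenceFamily d B → ExistsDiffFamilyOfType 2 (2 ^ suc m ∸ 1)
  liftedFamily {B} (blocks , differences-tile) =
    spread , spread-partialSpread , spread-type , liftedTriples B , distinct ,
    λ { (t , c) → inside t c , outside t c }
    where
    distinct : All Distinct (liftedTriples B)
    distinct = All.concat⁺ (All.map⁺ (All.map (λ {b} block → All.map⁺ (All.universal (develop-distinct b block) _)) blocks))
    count-lifted : ∀ t c → count (t , c) (Δ (liftedTriples B)) ≡ #ℕ.count (toℕ c) (progression 1 1 d′)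
    count-lifted t c = trans (count-Δ-liftedTriples blocks t c) (#ℕ.count-↭ (toℕ c) differences-tile)
    inside : ∀ t c → InUnion (t , c) spread → count (t , c) (Δ (liftedTriples B)) ≡ 0
    inside t c in-union with inUnion⇒residue-zero in-union
    ... | refl = trans (count-lifted t zero) (count-interval-< {k = d′} (s≤s z≤n))
    outside : ∀ t c → ¬ InUnion (t , c) spread → count (t , c) (Δ (liftedTriples B)) ≡ 1
    outside t c not-in-union = trans (count-lifted t c) (count-interval-∈ (n≢0⇒n>0 residue-nonzero) (toℕ<n c))
      where
      residue-nonzero : toℕ c ≢ 0
      residue-nonzero toℕc≡0 =
        not-in-union (subst (λ c → InUnion (t , c) spread) (sym (toℕ-injective toℕc≡0)) (residue-zero⇒inUnion t))

proposition3p2 : (m d : ℕ) .{{_ : NonZero d}} → 2 ≤ m → d % 6 ≡ 1 →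
    Group.ExistsDiffFamilyOfType m d 2 (2 ^ m ∸ 1)
proposition3p2 (suc (suc k)) d (s≤s (s≤s z≤n)) d%6≡1 =
  lifted d (d / 6) (sym (trans (m≡m%n+[m/n]*n d 6) (cong (_+ d / 6 * 6) d%6≡1)))
  where
  -- Matching on the equation also rewrites d inside the irrelevant instance argument.
  lifted : ∀ d .{{_ : NonZero d}} n → suc (n * 6) ≡ d → Group.ExistsDiffFamilyOfType (2 + k) d 2 (2 ^ (2 + k) ∸ 1)
  lifted .(suc (n * 6)) n refl = Lifting.liftedFamily (orthomorphism k) (proj₂ (cyclicDifferenceFamily n))
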